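{- Let $\mathfrak S\subseteq\mathcal P(\Delta)$ be an adapted structure. Then for every type $A$ of System $\mathcal D_+$, the structure $|A|_{\mathfrak S}$ is $\mathfrak S$-saturated and closed under finite unions, and $\mathcal N(\mathfrak S)\subseteq|A|_{\mathfrak S}\subseteq\mathfrak S$.
   Context: Types of System $\mathcal D_+$ are $A,B::=X\mid A\to B\mid A\cap B$, with $X$ ranging over propositional variables. Resource terms $\Delta$ are given by $s::=x\mid\lambda x.s\mid\langle s\rangle\bar t$, with bags $\bar t=[t_1,\dots,t_n]$ finite multisets of resource terms. We write $\langle s\rangle\bar t_1\cdots\bar t_n$ for iterated application. For $a\subseteq\Delta$, $a^!$ is the set of all bags with elements in $a$. For $t\in\Delta$ and a bag $\bar s$, $t\langle\bar s/x\rangle$ is the set of terms obtained by replacing bijectively the free occurrences of $x$ in $t$ with the elements of $\bar s$; it is empty if their numbers differ. For $e,a\subseteq\Delta$, $e\langle a^!/x\rangle=\bigcup_{t\in e,\bar s\in a^!}t\langle\bar s/x\rangle$, and $\langle f\rangle a_1^!\cdots a_n^!=\{\langle s\rangle\bar t_1\cdots\bar t_n:s\in f,\bar t_i\in a_i^!\}$. A structure is a subset of $\mathcal P(\Delta)$. For structures $\mathfrak S,\mathfrak S'$: - $\mathfrak S\to\mathfrak S'=\{f\subseteq\Delta:\forall a\in\mathfrak S,\ \langle f\rangle a^!\in\mathfrak S'\}$. - $\mathfrak S'$ is $\mathfrak S$-saturated if for all $e,f_0,\dots,f_n\in\mathfrak S$, $\langle e\langle f_0^!/x\rangle\rangle f_1^!\cdots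 f_n^!\in\mathfrak S'$ implies $\langle\lambda x.e\rangle f_0^!f_1^!\cdots f_n^!\in\mathfrak S'$. - $\mathcal N(\mathfrak S)=\{\{x\}:x\text{ variable}\}\cup\{\langle x\rangle a_1^!\cdots a_n^!:x\text{ variable}, n>0, a_i\in\mathfrak S\}$. - $\mathfrak S$ is adapted if: (1) $\mathfrak S$ is $\mathfrak S$-saturated; (2) $\mathcal N(\mathfrak S)\subseteq(\mathfrak S\to\mathcal N(\mathfrak S))\subseteq(\mathcal N(\mathfrak S)\to\mathfrak S)\subseteq\mathfrak S$; (3) $\mathfrak S$ is closed under binary unions. Realizers are defined by $|X|_{\mathfrak S}=\mathfrak S$, $|A\to B|_{\mathfrak S}=|A|_{\mathfrak S}\to|B|_{\mathfrak S}$, and $|A\cap B|_{\mathfrak S}=|A|_{\mathfrak S}\cap|B|_{\mathfrak S}$. -}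

module Defs where

open import Level using (Level; 0ℓ) renaming (suc to lsuc)
open import Data.Nat using (ℕ; _≟_)
open import Data.Bool using (if_then_else_)
open import Data.List using (List; []; _∷_; _++_)
open import Data.List.Relation.Unary.All using (All)
open import Data.List.Relation.Unary.Any using (Any)
open import Data.List.Relation.Binary.Permutation.Propositional using (_↭_)
open import Data.Product using (Σ; ∃; _×_; _,_)
open import Data.Sum using (_⊎_)
open import Relation.Nullary using (¬_; does)
open import Relation.Binary.PropositionalEquality using (_≡_; _≢_)

infixr 30 _⇒_
infixr 35 _∩_

data Ty : Set where
  tvar : ℕ → Ty
  _⇒_  : Ty → Ty → Ty
  _∩_  : Ty → Ty → Ty

-- Raw resource terms (variables are natural numbers; a bag is a list,
-- taken up to permutation via the equivalence _≅_ below).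

data Term : Set where
  var : ℕ → Term
  lam : ℕ → Term → Term
  app : Term → List Term → Term

Bag : Set
Bag = List Term

data Free (x : ℕ) : Term → Set where
  fvar : Free x (var x)
  flam : ∀ {y t} → y ≢ x → Free x t → Free x (lam y t)
  ffun : ∀ {t ts} → Free x t → Free x (app t ts)
  farg : ∀ {t ts} → Any (Free x) ts → Free x (app t ts)

data Occ (x : ℕ) : Term → Set where
  ovar  : Occ x (var x)
  obind : ∀ {t} → Occ x (lam x t)
  olam  : ∀ {y t} → Occ x t → Occ x (lam y t)
  ofun  : ∀ {t ts} → Occ x t → Occ x (app t ts)
  oarg  : ∀ {t ts} → Any (Occ x) ts → Occ x (app t ts)

-- renaming of the free occurrences of x into y (used only with y not
-- occurring in the term, where it is capture-free)
mutual
  rename : ℕ → ℕ → Term → Term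
  rename x y (var z) = if does (z ≟ x) then var y else var z
  rename x y (lam z t) = if does (z ≟ x) then lam z t else lam z (rename x y t)
  rename x y (app t ts) = app (rename x y t) (renameBag x y ts)

  renameBag : ℕ → ℕ → Bag → Bag
  renameBag x y [] = []
  renameBag x y (t ∷ ts) = rename x y t ∷ renameBag x y ts

mutual
  data _≅_ : Term → Term → Set where
    ≅-refl  : ∀ {s} → s ≅ s
    ≅-sym   : ∀ {s t} → s ≅ t → t ≅ s
    ≅-trans : ∀ {s t u} → s ≅ t → t ≅ u → s ≅ u
    ≅-lam   : ∀ {x s s'} → s ≅ s' → lam x s ≅ lam x s'
    ≅-app   : ∀ {s s' ts ts'} → s ≅ s' → ts ≅ᵇ ts' → app s ts ≅ app s' ts'
    ≅-α     : ∀ {x y s} → ¬ Occ y s → lam x s ≅ lam y (rename x y s)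

  data _≅ᵇ_ : Bag → Bag → Set where
    ≅ᵇ-[]    : [] ≅ᵇ []
    ≅ᵇ-∷     : ∀ {t t' ts ts'} → t ≅ t' → ts ≅ᵇ ts' → (t ∷ ts) ≅ᵇ (t' ∷ ts')
    ≅ᵇ-swap  : ∀ {t u ts} → (t ∷ u ∷ ts) ≅ᵇ (u ∷ t ∷ ts)
    ≅ᵇ-trans : ∀ {ts us vs} → ts ≅ᵇ us → us ≅ᵇ vs → ts ≅ᵇ vs

-- Linear substitution relation:  Sub x t s̄ u  means  u ∈ t⟨s̄/x⟩
-- (free occurrences of x in t replaced bijectively by the elements of s̄,
-- capture-avoiding; α-variants are accounted for by _≅_-closure of sets).
mutual
  data Sub (x : ℕ) : Term → Bag → Term → Set where
    sub-hit  : ∀ {s} → Sub x (var x) (s ∷ []) s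
    sub-miss : ∀ {y} → y ≢ x → Sub x (var y) [] (var y)
    sub-lamx : ∀ {t} → Sub x (lam x t) [] (lam x t)
    sub-lam  : ∀ {y t ss u} → y ≢ x → All (λ s → ¬ Free y s) ss →
               Sub x t ss u → Sub x (lam y t) ss (lam y u)
    sub-app  : ∀ {t ts ss ss₀ ss₁ u us} → Sub x t ss₀ u → SubBag x ts ss₁ us →
               ss ↭ (ss₀ ++ ss₁) → Sub x (app t ts) ss (app u us)

  data SubBag (x : ℕ) : Bag → Bag → Bag → Set where
    subb-[] : SubBag x [] [] []
    subb-∷  : ∀ {t ts ss₀ ss₁ u us} → Sub x t ss₀ u → SubBag x ts ss₁ us →
              SubBag x (t ∷ ts) (ss₀ ++ ss₁) (u ∷ us)

-- Subsets of Δ: predicates on raw terms closed under _≅_.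

record TSet : Set₁ where
  field
    mem    : Term → Set
    closed : ∀ {s t} → s ≅ t → mem s → mem t
open TSet public

_≐_ : TSet → TSet → Set
a ≐ b = ∀ u → (mem a u → mem b u) × (mem b u → mem a u)

single : ℕ → TSet
single x = record { mem = λ u → u ≅ var x ; closed = λ p q → ≅-trans (≅-sym p) q }

_∪_ : TSet → TSet → TSet
a ∪ b = record { mem = λ u → mem a u ⊎ mem b u
               ; closed = λ { p (Data.Sum.inj₁ m) → Data.Sum.inj₁ (closed a p m)
                            ; p (Data.Sum.inj₂ m) → Data.Sum.inj₂ (closed b p m) } }

⋃⁺ : TSet → List TSet → TSet
⋃⁺ a [] = a
⋃⁺ a (b ∷ bs) = a ∪ ⋃⁺ b bs

app! : TSet → TSet → TSet
app! f a = record
  { mem = λ u → Σ Term λ s → Σ Bag λ ts → mem f s × All (mem a) ts × u ≅ app s ts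
  ; closed = λ { p (s , ts , fs , as , q) → s , ts , fs , as , ≅-trans (≅-sym p) q } }

apps! : TSet → List TSet → TSet
apps! f [] = f
apps! f (a ∷ as) = apps! (app! f a) as

lamS : ℕ → TSet → TSet
lamS x e = record
  { mem = λ u → Σ Term λ s → mem e s × u ≅ lam x s
  ; closed = λ { p (s , es , q) → s , es , ≅-trans (≅-sym p) q } }

substS : TSet → TSet → ℕ → TSet
substS e a x = record
  { mem = λ u → Σ Term λ t → Σ Bag λ ss → Σ Term λ u' →
                mem e t × All (mem a) ss × Sub x t ss u' × u ≅ u'
  ; closed = λ { p (t , ss , u' , es , as , sb , q) →
                 t , ss , u' , es , as , sb , ≅-trans (≅-sym p) q } }

-- Structures: subsets of P(Δ), as predicates on TSet.

Structure : Set₂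
Structure = TSet → Set₁

-- a genuine set of subsets of Δ does not distinguish extensionally equal subsets
Extensional : Structure → Set₁
Extensional 𝔖 = ∀ a b → a ≐ b → 𝔖 a → 𝔖 b

_⊆S_ : Structure → Structure → Set₁
𝔖 ⊆S 𝔖' = ∀ a → 𝔖 a → 𝔖' a

_⟶_ : Structure → Structure → Structure
(𝔖 ⟶ 𝔖') f = ∀ a → 𝔖 a → 𝔖' (app! f a)

_∩S_ : Structure → Structure → Structure
(𝔖 ∩S 𝔖') a = 𝔖 a × 𝔖' a

Saturated : Structure → Structure → Set₁
Saturated 𝔖 𝔖' = ∀ (x : ℕ) (e f₀ : TSet) (fs : List TSet) →
  𝔖 e → 𝔖 f₀ → All 𝔖 fs →
  𝔖' (apps! (substS e f₀ x) fs) → 𝔖' (apps! (lamS x e) (f₀ ∷ fs))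

𝒩 : Structure → Structure
𝒩 𝔖 a = (Σ ℕ λ x → a ≐ single x)
      ⊎ (Σ ℕ λ x → Σ TSet λ a₁ → Σ (List TSet) λ as →
           All 𝔖 (a₁ ∷ as) × a ≐ apps! (single x) (a₁ ∷ as))

BinUnionClosed : Structure → Set₁
BinUnionClosed 𝔖 = ∀ a b → 𝔖 a → 𝔖 b → 𝔖 (a ∪ b)

FinUnionClosed : Structure → Set₁
FinUnionClosed 𝔖 = ∀ a as → 𝔖 a → All 𝔖 as → 𝔖 (⋃⁺ a as)

record Adapted (𝔖 : Structure) : Set₁ where
  field
    saturated : Saturated 𝔖 𝔖
    N⊆S⟶N     : 𝒩 𝔖 ⊆S (𝔖 ⟶ 𝒩 𝔖)
    S⟶N⊆N⟶S   : (𝔖 ⟶ 𝒩 𝔖) ⊆S (𝒩 𝔖 ⟶ 𝔖)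
    N⟶S⊆S     : (𝒩 𝔖 ⟶ 𝔖) ⊆S 𝔖
    unions    : BinUnionClosed 𝔖

∣_∣_ : Ty → Structure → Structure
∣ tvar X ∣ 𝔖 = 𝔖
∣ A ⇒ B ∣ 𝔖 = (∣ A ∣ 𝔖) ⟶ (∣ B ∣ 𝔖)
∣ A ∩ B ∣ 𝔖 = (∣ A ∣ 𝔖) ∩S (∣ B ∣ 𝔖)

-- By induction on A, carrying the invariant that |A| is an extensional,
-- 𝔖-saturated, union-closed structure lying between 𝒩(𝔖) and 𝔖.
-- Saturation of |B| for one more argument f_{n+1} ∈ |A| ⊆ 𝔖 gives saturation
-- of |A → B|; the bounds follow from the antitone/monotone behaviour of _⟶_
-- together with the chain 𝒩 ⊆ (𝔖 ⟶ 𝒩) ⊆ (𝒩 ⟶ 𝔖) ⊆ 𝔖 of an adapted structure.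
-- Extensionality is carried along because ⟨f ∪ g⟩a^! and ⟨f⟩a^! ∪ ⟨g⟩a^! are
-- equal only up to _≐_.
module Submission where

open import Defs
open import Data.Product using (_×_; _,_; proj₁; proj₂)
open import Data.Sum using (inj₁; inj₂)
open import Data.List using (List; []; _∷_; _++_)
open import Data.List.Relation.Unary.All using (All; []; _∷_)
open import Data.List.Relation.Unary.All.Properties using (++⁺)
open import Relation.Binary.PropositionalEquality using (_≡_; refl; subst; sym)

app!-cong : ∀ f g a → f ≐ g → app! f a ≐ app! g a
app!-cong f g a e u =
  (λ { (s , ts , m , as , q) → s , ts , proj₁ (e s) m , as , q }) ,
  (λ { (s , ts , m , as , q) → s , ts , proj₂ (e s) m , as , q })

app!-distribʳ-∪ : ∀ f g a → (app! f a ∪ app! g a) ≐ app! (f ∪ g) a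
app!-distribʳ-∪ f g a u =
  (λ { (inj₁ (s , ts , m , as , q)) → s , ts , inj₁ m , as , q
     ; (inj₂ (s , ts , m , as , q)) → s , ts , inj₂ m , as , q }) ,
  (λ { (s , ts , inj₁ m , as , q) → inj₁ (s , ts , m , as , q)
     ; (s , ts , inj₂ m , as , q) → inj₂ (s , ts , m , as , q) })

apps!-snoc : ∀ f fs a → apps! f (fs ++ a ∷ []) ≡ app! (apps! f fs) a
apps!-snoc f []       a = refl
apps!-snoc f (b ∷ fs) a = apps!-snoc (app! f b) fs a

⊆S-trans : ∀ {𝔖₁ 𝔖₂ 𝔖₃} → 𝔖₁ ⊆S 𝔖₂ → 𝔖₂ ⊆S 𝔖₃ → 𝔖₁ ⊆S 𝔖₃
⊆S-trans p q a m = q a (p a m)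

⟶-mono : ∀ {𝔖₁ 𝔖₁' 𝔖₂ 𝔖₂'} → 𝔖₁' ⊆S 𝔖₁ → 𝔖₂ ⊆S 𝔖₂' →
         (𝔖₁ ⟶ 𝔖₂) ⊆S (𝔖₁' ⟶ 𝔖₂')
⟶-mono p q f m a ma = q (app! f a) (m a (p a ma))

⟶-extensional : ∀ {𝔖 𝔖'} → Extensional 𝔖' → Extensional (𝔖 ⟶ 𝔖')
⟶-extensional ext' f g e m a ma = ext' _ _ (app!-cong f g a e) (m a ma)

⟶-binUnionClosed : ∀ {𝔖 𝔖'} → Extensional 𝔖' → BinUnionClosed 𝔖' →
                   BinUnionClosed (𝔖 ⟶ 𝔖')
⟶-binUnionClosed ext' ∪' f g mf mg a ma =
  ext' _ _ (app!-distribʳ-∪ f g a) (∪' _ _ (mf a ma) (mg a ma))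

⟶-saturated : ∀ {𝔖 𝔖₁ 𝔖₂} → 𝔖₁ ⊆S 𝔖 → Saturated 𝔖 𝔖₂ →
              Saturated 𝔖 (𝔖₁ ⟶ 𝔖₂)
⟶-saturated {𝔖₂ = 𝔖₂} 𝔖₁⊆𝔖 sat₂ x e f₀ fs se sf₀ sfs h a ma =
  subst 𝔖₂ (apps!-snoc (lamS x e) (f₀ ∷ fs) a)
    (sat₂ x e f₀ (fs ++ a ∷ []) se sf₀ (++⁺ sfs (𝔖₁⊆𝔖 a ma ∷ []))
      (subst 𝔖₂ (sym (apps!-snoc (substS e f₀ x) fs a)) (h a ma)))

∩S-extensional : ∀ {𝔖₁ 𝔖₂} → Extensional 𝔖₁ → Extensional 𝔖₂ →
                 Extensional (𝔖₁ ∩S 𝔖₂)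
∩S-extensional ext₁ ext₂ a b e (m₁ , m₂) = ext₁ a b e m₁ , ext₂ a b e m₂

∩S-binUnionClosed : ∀ {𝔖₁ 𝔖₂} → BinUnionClosed 𝔖₁ → BinUnionClosed 𝔖₂ →
                    BinUnionClosed (𝔖₁ ∩S 𝔖₂)
∩S-binUnionClosed ∪₁ ∪₂ a b (ma₁ , ma₂) (mb₁ , mb₂) = ∪₁ a b ma₁ mb₁ , ∪₂ a b ma₂ mb₂

∩S-saturated : ∀ {𝔖 𝔖₁ 𝔖₂} → Saturated 𝔖 𝔖₁ → Saturated 𝔖 𝔖₂ →
               Saturated 𝔖 (𝔖₁ ∩S 𝔖₂)
∩S-saturated sat₁ sat₂ x e f₀ fs se sf₀ sfs (h₁ , h₂) =
  sat₁ x e f₀ fs se sf₀ sfs h₁ , sat₂ x e f₀ fs se sf₀ sfs h₂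

binUnionClosed⇒finUnionClosed : ∀ {𝔖} → BinUnionClosed 𝔖 → FinUnionClosed 𝔖
binUnionClosed⇒finUnionClosed ∪' a []       m []         = m
binUnionClosed⇒finUnionClosed ∪' a (b ∷ bs) m (mb ∷ mbs) =
  ∪' a _ m (binUnionClosed⇒finUnionClosed ∪' b bs mb mbs)

record Candidate (𝔖 T : Structure) : Set₁ where
  field
    saturated   : Saturated 𝔖 T
    unions      : BinUnionClosed T
    extensional : Extensional T
    𝒩⊆          : 𝒩 𝔖 ⊆S T
    ⊆𝔖          : T ⊆S 𝔖

module _ {𝔖 : Structure} (ext : Extensional 𝔖) (adapted : Adapted 𝔖) where
  open Adapted adapted using (N⊆S⟶N; S⟶N⊆N⟶S; N⟶S⊆S)
  open Candidate

  adapted-candidate : Candidate 𝔖 𝔖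
  adapted-candidate = record
    { saturated   = Adapted.saturated adapted
    ; unions      = Adapted.unions adapted
    ; extensional = ext
    ; 𝒩⊆          = ⊆S-trans N⊆S⟶N (⊆S-trans S⟶N⊆N⟶S N⟶S⊆S)
    ; ⊆𝔖          = λ a m → m
    }

  ⟶-candidate : ∀ {T U} → Candidate 𝔖 T → Candidate 𝔖 U → Candidate 𝔖 (T ⟶ U)
  ⟶-candidate {T} {U} cT cU = record
    { saturated   = ⟶-saturated {𝔖₁ = T} {𝔖₂ = U} (⊆𝔖 cT) (saturated cU)
    ; unions      = ⟶-binUnionClosed {T} (extensional cU) (unions cU)
    ; extensional = ⟶-extensional {T} (extensional cU)
    ; 𝒩⊆          = ⊆S-trans N⊆S⟶N (⟶-mono (⊆𝔖 cT) (𝒩⊆ cU))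
    ; ⊆𝔖          = ⊆S-trans (⟶-mono (𝒩⊆ cT) (⊆𝔖 cU)) N⟶S⊆S
    }

  ∩S-candidate : ∀ {T U} → Candidate 𝔖 T → Candidate 𝔖 U → Candidate 𝔖 (T ∩S U)
  ∩S-candidate {T} {U} cT cU = record
    { saturated   = ∩S-saturated {𝔖₁ = T} {𝔖₂ = U} (saturated cT) (saturated cU)
    ; unions      = ∩S-binUnionClosed (unions cT) (unions cU)
    ; extensional = ∩S-extensional (extensional cT) (extensional cU)
    ; 𝒩⊆          = λ a m → 𝒩⊆ cT a m , 𝒩⊆ cU a m
    ; ⊆𝔖          = λ a m → ⊆𝔖 cT a (proj₁ m)
    }

  realizers-candidate : ∀ A → Candidate 𝔖 (∣ A ∣ 𝔖)
  realizers-candidate (tvar X) = adapted-candidate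
  realizers-candidate (A ⇒ B)  = ⟶-candidate (realizers-candidate A) (realizers-candidate B)
  realizers-candidate (A ∩ B)  = ∩S-candidate (realizers-candidate A) (realizers-candidate B)

lemma1 : (𝔖 : Structure) → Extensional 𝔖 → Adapted 𝔖 → (A : Ty) →
    Saturated 𝔖 (∣ A ∣ 𝔖) × FinUnionClosed (∣ A ∣ 𝔖) ×
    (𝒩 𝔖 ⊆S (∣ A ∣ 𝔖)) × ((∣ A ∣ 𝔖) ⊆S 𝔖)
lemma1 𝔖 ext adapted A =
  saturated , binUnionClosed⇒finUnionClosed unions , 𝒩⊆ , ⊆𝔖
  where open Candidate (realizers-candidate ext adapted A)
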